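{- Let $f(2),f(3),\dots$ be real numbers with $0\leq f(2)\leq f(3)\leq\cdots$, and set $f(1):=0$. Define, for $n\geq 1$, \[ a(n):=n\sum_{i=1}^{n}\frac{f(i)}{i^2} \] (so $a(1)=0$). Then for all integers $n,m\geq 1$, \[ a(n+m)\leq a(n)+a(m)+f(n+m). \] -}

module Defs where

open import Level using (Level; _⊔_)
open import Data.Nat as ℕ using (ℕ; zero; suc)
open import Relation.Nullary using (¬_)
open import Relation.Binary.Structures using (IsTotalOrder)
open import Algebra.Bundles using (CommutativeRing)

-- An ordered field: a commutative ring with a total order compatible with
-- + and *, 0 ≠ 1, and multiplicative inverses of nonzero elements.
-- (0 ≤ 1 is derivable from the others; included for convenience.)
record OrderedField (c ℓ₁ ℓ₂ : Level) : Set (Level.suc (c ⊔ ℓ₁ ⊔ ℓ₂)) where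
  field
    commutativeRing : CommutativeRing c ℓ₁
  open CommutativeRing commutativeRing public
  infix 4 _≤_
  field
    _≤_          : Carrier → Carrier → Set ℓ₂
    isTotalOrder : IsTotalOrder _≈_ _≤_
    +-monoˡ-≤    : ∀ {x y} z → x ≤ y → x + z ≤ y + z
    *-nonneg     : ∀ {x y} → 0# ≤ x → 0# ≤ y → 0# ≤ x * y
    0≤1          : 0# ≤ 1#
    0≉1          : ¬ (0# ≈ 1#)
    inv          : (x : Carrier) → ¬ (x ≈ 0#) → Carrier
    inv-inverse  : ∀ x (p : ¬ (x ≈ 0#)) → x * inv x p ≈ 1#
  open IsTotalOrder isTotalOrder public
    using () renaming (refl to ≤-refl; antisym to ≤-antisym; trans to ≤-trans;
                       reflexive to ≤-reflexive; total to ≤-total)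

module Harmonic {c ℓ₁ ℓ₂} (F : OrderedField c ℓ₁ ℓ₂) where
  open OrderedField F

  fromℕ : ℕ → Carrier
  fromℕ zero    = 0#
  fromℕ (suc n) = 1# + fromℕ n

  private
    0≤x⇒0≤1+x : ∀ {x} → 0# ≤ x → 0# ≤ 1# + x
    0≤x⇒0≤1+x {x} p =
      ≤-trans 0≤1 (≤-trans (≤-reflexive (sym (+-identityʳ 1#)))
        (≤-trans (≤-reflexive (+-comm 1# 0#))
          (≤-trans (+-monoˡ-≤ 1# p) (≤-reflexive (+-comm x 1#)))))

  0≤fromℕ : ∀ n → 0# ≤ fromℕ n
  0≤fromℕ zero    = ≤-refl
  0≤fromℕ (suc n) = 0≤x⇒0≤1+x (0≤fromℕ n)

  fromℕ-suc≉0 : ∀ n → ¬ (fromℕ (suc n) ≈ 0#)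
  fromℕ-suc≉0 n eq = 0≉1 (≤-antisym 0≤1 1≤0)
    where
    1≤0 : 1# ≤ 0#
    1≤0 = ≤-trans (≤-reflexive (sym (+-identityˡ 1#)))
            (≤-trans (≤-reflexive (+-comm 0# 1#))
              (≤-trans (≤-reflexive (+-comm 1# 0#))
                (≤-trans (+-monoˡ-≤ 1# (0≤fromℕ n))
                  (≤-trans (≤-reflexive (+-comm (fromℕ n) 1#)) (≤-reflexive eq)))))

  invSuc : ℕ → Carrier
  invSuc n = inv (fromℕ (suc n)) (fromℕ-suc≉0 n)

  S : (ℕ → Carrier) → ℕ → Carrier
  S f zero    = 0#
  S f (suc n) = S f n + f (suc n) * (invSuc n * invSuc n)

  a : (ℕ → Carrier) → ℕ → Carrier
  a f n = fromℕ n * S f n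

-- Fix N = n + m and c = f(N). Since f(i) ≤ c for 2 ≤ i ≤ N and 1/i² ≤ 1/(i-1) − 1/i,
-- each term f(i)/i² with i ≥ 2 is at most c/(i-1) − c/i, so S(k) + c/k is
-- nonincreasing for 1 ≤ k ≤ N. Hence S(N) + c/N ≤ S(n) + c/n and S(N) + c/N ≤ S(m) + c/m;
-- multiplying by n and by m and adding gives a(N) + c ≤ a(n) + a(m) + 2c.
module Submission where

open import Defs
open import Level using (Level)
open import Data.Nat using (ℕ; suc; _+_) renaming (_≤_ to _≤ℕ_)
open import Data.Nat using (zero; s≤s; z≤n; _≤′_; ≤′-refl; ≤′-step)
import Data.Nat.Properties as ℕ
open import Data.Sum using (inj₁; inj₂)
open import Relation.Nullary using (contradiction)
open import Relation.Binary.Bundles using (Poset)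
open import Relation.Binary.Structures using (IsTotalOrder)
import Relation.Binary.Reasoning.PartialOrder as PosetReasoning

module OrderedFieldProperties {c ℓ₁ ℓ₂} (F : OrderedField c ℓ₁ ℓ₂) where
  open OrderedField F renaming (_+_ to _⊕_)
  open import Algebra.Properties.Ring ring using (-‿distribʳ-*)

  poset : Poset c ℓ₁ ℓ₂
  poset = record { isPartialOrder = IsTotalOrder.isPartialOrder isTotalOrder }

  open PosetReasoning poset

  +-monoʳ-≤ : ∀ z {x y} → x ≤ y → z ⊕ x ≤ z ⊕ y
  +-monoʳ-≤ z {x} {y} x≤y = begin
    z ⊕ x  ≈⟨ +-comm z x ⟩
    x ⊕ z  ≤⟨ +-monoˡ-≤ z x≤y ⟩
    y ⊕ z  ≈⟨ +-comm y z ⟩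
    z ⊕ y  ∎

  +-mono-≤ : ∀ {x y u v} → x ≤ y → u ≤ v → x ⊕ u ≤ y ⊕ v
  +-mono-≤ {y = y} {u} x≤y u≤v = ≤-trans (+-monoˡ-≤ u x≤y) (+-monoʳ-≤ y u≤v)

  +-cancelʳ-≤ : ∀ z {x y} → x ⊕ z ≤ y ⊕ z → x ≤ y
  +-cancelʳ-≤ z {x} {y} x+z≤y+z = begin
    x                ≈⟨ z-cancels x ⟨
    (x ⊕ z) ⊕ (- z)  ≤⟨ +-monoˡ-≤ (- z) x+z≤y+z ⟩
    (y ⊕ z) ⊕ (- z)  ≈⟨ z-cancels y ⟩
    y                ∎
    where
    z-cancels : ∀ w → (w ⊕ z) ⊕ (- z) ≈ w
    z-cancels w = trans (+-assoc w z (- z)) (trans (+-congˡ (-‿inverseʳ z)) (+-identityʳ w))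

  x≤y⇒0≤y-x : ∀ {x y} → x ≤ y → 0# ≤ y ⊕ (- x)
  x≤y⇒0≤y-x {x} {y} x≤y = begin
    0#          ≈⟨ -‿inverseʳ x ⟨
    x ⊕ (- x)   ≤⟨ +-monoˡ-≤ (- x) x≤y ⟩
    y ⊕ (- x)   ∎

  *-monoˡ-≤-nonneg : ∀ {z} → 0# ≤ z → ∀ {x y} → x ≤ y → z * x ≤ z * y
  *-monoˡ-≤-nonneg {z} 0≤z {x} {y} x≤y = begin
    z * x                       ≈⟨ +-identityˡ (z * x) ⟨
    0# ⊕ z * x                  ≤⟨ +-monoˡ-≤ (z * x) (*-nonneg 0≤z (x≤y⇒0≤y-x x≤y)) ⟩
    z * (y ⊕ (- x)) ⊕ z * x     ≈⟨ distribˡ z (y ⊕ (- x)) x ⟨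
    z * ((y ⊕ (- x)) ⊕ x)       ≈⟨ *-congˡ (trans (+-assoc y (- x) x)
                                    (trans (+-congˡ (-‿inverseˡ x)) (+-identityʳ y))) ⟩
    z * y                       ∎

  *-monoʳ-≤-nonneg : ∀ {z} → 0# ≤ z → ∀ {x y} → x ≤ y → x * z ≤ y * z
  *-monoʳ-≤-nonneg {z} 0≤z {x} {y} x≤y = begin
    x * z  ≈⟨ *-comm x z ⟩
    z * x  ≤⟨ *-monoˡ-≤-nonneg 0≤z x≤y ⟩
    z * y  ≈⟨ *-comm z y ⟩
    y * z  ∎

  x*y≈1⇒0≤y : ∀ {x y} → 0# ≤ x → x * y ≈ 1# → 0# ≤ y
  x*y≈1⇒0≤y {x} {y} 0≤x xy≈1 with ≤-total 0# y
  ... | inj₁ 0≤y = 0≤y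
  ... | inj₂ y≤0 = contradiction (≤-antisym 0≤1 1≤0) 0≉1
    where
    0≤-y : 0# ≤ - y
    0≤-y = begin
      0#         ≈⟨ -‿inverseʳ y ⟨
      y ⊕ (- y)  ≤⟨ +-monoˡ-≤ (- y) y≤0 ⟩
      0# ⊕ (- y) ≈⟨ +-identityˡ (- y) ⟩
      - y        ∎
    1≤0 : 1# ≤ 0#
    1≤0 = begin
      1#             ≈⟨ +-identityˡ 1# ⟨
      0# ⊕ 1#        ≤⟨ +-monoˡ-≤ 1# (*-nonneg 0≤x 0≤-y) ⟩
      x * (- y) ⊕ 1# ≈⟨ +-congʳ (trans (sym (-‿distribʳ-* x y)) (-‿cong xy≈1)) ⟩
      - 1# ⊕ 1#      ≈⟨ -‿inverseˡ 1# ⟩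
      0#             ∎

  stepwise⇒monotone : ∀ {b} (g : ℕ → Carrier) → (∀ i → b ≤ℕ i → g i ≤ g (suc i)) →
                      ∀ {i k} → b ≤ℕ i → i ≤ℕ k → g i ≤ g k
  stepwise⇒monotone {b} g step b≤i i≤k = go b≤i (ℕ.≤⇒≤′ i≤k)
    where
    go : ∀ {i k} → b ≤ℕ i → i ≤′ k → g i ≤ g k
    go b≤i ≤′-refl         = ≤-refl
    go b≤i (≤′-step i≤′k) = ≤-trans (go b≤i i≤′k) (step _ (ℕ.≤-trans b≤i (ℕ.≤′⇒≤ i≤′k)))

module HarmonicProperties {c ℓ₁ ℓ₂} (F : OrderedField c ℓ₁ ℓ₂) where
  open OrderedField F renaming (_+_ to _⊕_)
  open Harmonic F
  open OrderedFieldProperties F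
  open PosetReasoning poset
  open import Algebra.Properties.CommutativeSemigroup *-commutativeSemigroup using (x∙yz≈y∙xz)
  open import Algebra.Solver.Ring.NaturalCoefficients.Default commutativeSemiring

  fromℕ-+ : ∀ m n → fromℕ (m + n) ≈ fromℕ m ⊕ fromℕ n
  fromℕ-+ zero    n = sym (+-identityˡ (fromℕ n))
  fromℕ-+ (suc m) n = trans (+-congˡ (fromℕ-+ m n)) (sym (+-assoc 1# (fromℕ m) (fromℕ n)))

  fromℕ*invSuc≈1 : ∀ n → fromℕ (suc n) * invSuc n ≈ 1#
  fromℕ*invSuc≈1 n = inv-inverse (fromℕ (suc n)) (fromℕ-suc≉0 n)

  0≤invSuc : ∀ n → 0# ≤ invSuc n
  0≤invSuc n = x*y≈1⇒0≤y (0≤fromℕ (suc n)) (fromℕ*invSuc≈1 n)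

  invSuc-split : ∀ n → invSuc n ≈ invSuc (suc n) ⊕ invSuc n * invSuc (suc n)
  invSuc-split n = begin-equality
    v                           ≈⟨ *-identityʳ v ⟨
    v * 1#                      ≈⟨ *-congˡ (fromℕ*invSuc≈1 (suc n)) ⟨
    v * ((1# ⊕ x) * w)          ≈⟨ solve 3 (λ v w x → v :* ((con 1 :+ x) :* w) := v :* w :+ (x :* v) :* w)
                                     refl v w x ⟩
    v * w ⊕ (x * v) * w         ≈⟨ +-congˡ (trans (*-congʳ (fromℕ*invSuc≈1 n)) (*-identityˡ w)) ⟩
    v * w ⊕ w                   ≈⟨ +-comm (v * w) w ⟩
    w ⊕ v * w                   ∎
    where
    v w x : Carrier
    v = invSuc n
    w = invSuc (suc n)
    x = fromℕ (suc n)

  invSuc-suc²+invSuc-suc≤invSuc : ∀ n → invSuc (suc n) * invSuc (suc n) ⊕ invSuc (suc n) ≤ invSuc n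
  invSuc-suc²+invSuc-suc≤invSuc n = begin
    w * w ⊕ w   ≤⟨ +-monoˡ-≤ w (*-monoʳ-≤-nonneg (0≤invSuc (suc n)) w≤v) ⟩
    v * w ⊕ w   ≈⟨ +-comm (v * w) w ⟩
    w ⊕ v * w   ≈⟨ invSuc-split n ⟨
    v           ∎
    where
    v w : Carrier
    v = invSuc n
    w = invSuc (suc n)
    w≤v : w ≤ v
    w≤v = begin
      w          ≈⟨ +-identityʳ w ⟨
      w ⊕ 0#     ≤⟨ +-monoʳ-≤ w (*-nonneg (0≤invSuc n) (0≤invSuc (suc n))) ⟩
      w ⊕ v * w  ≈⟨ invSuc-split n ⟨
      v          ∎

  -- Sᶜ f c k is S(k+1) + c/(k+1) in the notation of the paper.
  Sᶜ : (ℕ → Carrier) → Carrier → ℕ → Carrier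
  Sᶜ f c k = S f (suc k) ⊕ c * invSuc k

  Sᶜ-step : ∀ f {c} → 0# ≤ c → ∀ k → f (suc (suc k)) ≤ c → Sᶜ f c (suc k) ≤ Sᶜ f c k
  Sᶜ-step f {c} 0≤c k f[k+2]≤c = begin
    (S f (suc k) ⊕ f (suc (suc k)) * (w * w)) ⊕ c * w
      ≈⟨ +-assoc (S f (suc k)) _ (c * w) ⟩
    S f (suc k) ⊕ (f (suc (suc k)) * (w * w) ⊕ c * w)
      ≤⟨ +-monoʳ-≤ (S f (suc k)) (+-monoˡ-≤ (c * w) (*-monoʳ-≤-nonneg 0≤w² f[k+2]≤c)) ⟩
    S f (suc k) ⊕ (c * (w * w) ⊕ c * w)
      ≈⟨ +-congˡ (distribˡ c (w * w) w) ⟨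
    S f (suc k) ⊕ c * (w * w ⊕ w)
      ≤⟨ +-monoʳ-≤ (S f (suc k)) (*-monoˡ-≤-nonneg 0≤c (invSuc-suc²+invSuc-suc≤invSuc k)) ⟩
    S f (suc k) ⊕ c * invSuc k
      ∎
    where
    w : Carrier
    w = invSuc (suc k)
    0≤w² : 0# ≤ w * w
    0≤w² = *-nonneg (0≤invSuc (suc k)) (0≤invSuc (suc k))

  Sᶜ-antitone : ∀ f {c} → 0# ≤ c → ∀ {j k} → (∀ i → 2 ≤ℕ i → i ≤ℕ suc k → f i ≤ c) →
                j ≤ℕ k → Sᶜ f c k ≤ Sᶜ f c j
  Sᶜ-antitone f {c} 0≤c f≤c j≤k = go f≤c (ℕ.≤⇒≤′ j≤k)
    where
    go : ∀ {j k} → (∀ i → 2 ≤ℕ i → i ≤ℕ suc k → f i ≤ c) → j ≤′ k → Sᶜ f c k ≤ Sᶜ f c j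
    go f≤c ≤′-refl            = ≤-refl
    go f≤c (≤′-step {k} j≤′k) =
      ≤-trans (Sᶜ-step f 0≤c k (f≤c _ (s≤s (s≤s z≤n)) ℕ.≤-refl))
              (go (λ i 2≤i i≤k+1 → f≤c i 2≤i (ℕ.m≤n⇒m≤1+n i≤k+1)) j≤′k)

  fromℕ*Sᶜ≈a+c : ∀ f c k → fromℕ (suc k) * Sᶜ f c k ≈ a f (suc k) ⊕ c
  fromℕ*Sᶜ≈a+c f c k = begin-equality
    x * (S f (suc k) ⊕ c * invSuc k)  ≈⟨ distribˡ x (S f (suc k)) (c * invSuc k) ⟩
    a f (suc k) ⊕ x * (c * invSuc k)  ≈⟨ +-congˡ (x∙yz≈y∙xz x c (invSuc k)) ⟩
    a f (suc k) ⊕ c * (x * invSuc k)  ≈⟨ +-congˡ (trans (*-congˡ (fromℕ*invSuc≈1 k)) (*-identityʳ c)) ⟩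
    a f (suc k) ⊕ c                   ∎
    where
    x : Carrier
    x = fromℕ (suc k)

claim6p1 : ∀ {c ℓ₁ ℓ₂ : Level} (F : OrderedField c ℓ₁ ℓ₂) →
    let open Harmonic F in
    let open OrderedField F renaming (_+_ to _⊕_) in
    (f : ℕ → Carrier) →
    f 1 ≈ 0# →
    0# ≤ f 2 →
    (∀ i → 2 ≤ℕ i → f i ≤ f (suc i)) →
    ∀ n m → 1 ≤ℕ n → 1 ≤ℕ m →
    a f (n + m) ≤ (a f n ⊕ a f m) ⊕ f (n + m)
-- The value f 1 is never needed: it contributes N · f 1 to both sides.
claim6p1 F f _ 0≤f2 f-stepwise (suc p) (suc q) _ _ = +-cancelʳ-≤ c (begin
  a f N ⊕ c                                 ≈⟨ fromℕ*Sᶜ≈a+c f c j ⟨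
  fromℕ N * Sᶜ f c j                        ≈⟨ *-congʳ (fromℕ-+ n m) ⟩
  (fromℕ n ⊕ fromℕ m) * Sᶜ f c j            ≈⟨ distribʳ (Sᶜ f c j) (fromℕ n) (fromℕ m) ⟩
  fromℕ n * Sᶜ f c j ⊕ fromℕ m * Sᶜ f c j   ≤⟨ +-mono-≤ (*-monoˡ-≤-nonneg (0≤fromℕ n) (Sᶜ-antitone f 0≤c f≤c p≤j))
                                                         (*-monoˡ-≤-nonneg (0≤fromℕ m) (Sᶜ-antitone f 0≤c f≤c q≤j)) ⟩
  fromℕ n * Sᶜ f c p ⊕ fromℕ m * Sᶜ f c q   ≈⟨ +-cong (fromℕ*Sᶜ≈a+c f c p) (fromℕ*Sᶜ≈a+c f c q) ⟩
  (a f n ⊕ c) ⊕ (a f m ⊕ c)                 ≈⟨ interchange (a f n) c (a f m) c ⟩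
  (a f n ⊕ a f m) ⊕ (c ⊕ c)                 ≈⟨ +-assoc (a f n ⊕ a f m) c c ⟨
  ((a f n ⊕ a f m) ⊕ c) ⊕ c                 ∎)
  where
  open OrderedField F renaming (_+_ to _⊕_)
  open Harmonic F
  open OrderedFieldProperties F
  open HarmonicProperties F
  open PosetReasoning poset
  open import Algebra.Properties.CommutativeSemigroup +-commutativeSemigroup using (interchange)

  n m N j : ℕ
  n = suc p
  m = suc q
  N = n + m
  j = p + m
  c : Carrier
  c = f N

  p≤j : p ≤ℕ j
  p≤j = ℕ.m≤m+n p m
  q≤j : q ≤ℕ j
  q≤j = ℕ.≤-trans (ℕ.n≤1+n q) (ℕ.m≤n+m m p)

  f≤c : ∀ i → 2 ≤ℕ i → i ≤ℕ N → f i ≤ c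
  f≤c i 2≤i i≤N = stepwise⇒monotone f f-stepwise 2≤i i≤N
  0≤c : 0# ≤ c
  0≤c = ≤-trans 0≤f2 (f≤c 2 ℕ.≤-refl (s≤s (ℕ.≤-trans (s≤s z≤n) (ℕ.m≤n+m m p))))
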